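{- Let $G,H\in\mathcal E$. Then $G\geq_{\mathcal E}H$ if and only if all of the following hold: (1) $\hat o(G)\geq\hat o(H)$; (2) for every Left option $H^L$ of $H$, either there is a Left option $G^L$ of $G$ with $G^L\geq_{\mathcal E}H^L$, or there is a Right option $H^{LR}$ of $H^L$ with $G\geq_{\mathcal E}H^{LR}$; (3) for every Right option $G^R$ of $G$, either there is a Right option $H^R$ of $H$ with $G^R\geq_{\mathcal E}H^R$, or there is a Left option $G^{RL}$ of $G^R$ with $G^{RL}\geq_{\mathcal E}H$.
   Context: All games are short two-player partizan games between Left and Right, identified with their game trees: $G=\{G^{\mathcal L}\mid G^{\mathcal R}\}$ with finite sets of options. Followers of $G$: $G$, its options, their options, etc. Disjunctive sum: $G+H=\{G^{\mathcal L}+H,G+H^{\mathcal L}\mid G^{\mathcal R}+H,G+H^{\mathcal R}\}$. Misère play: a player with no move on their turn wins. $o_L(G)=\mathrm L$ if $G^{\mathcal L}=\emptyset$, else $\max_{G^L}o_R(G^L)$; $o_R(G)=\mathrm R$ if $G^{\mathcal R}=\emptyset$, else $\min_{G^R}o_L(G^R)$; $\mathrm L>\mathrm R$. $o(G)$ is the pair $(o_L(G),o_R(G))$, ordered componentwise. A Left-end has no Left option; a dead Left-end has only Left-ends as followers; similarly Right. A game is dead-ending if each follower that is a Left-end (Right-end) is a dead Left-end (dead Right-end); $\mathcal E$ is the class of dead-ending games. $G\geq_{\mathcal E}H$ means $o(G+X)\geq o(H+X)$ for all $X\in\mathcal E$. Strong outcomes: $\hat o_L(G)=\min\{o_L(G+X):X\in\mathcal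 E\text{ a Left-end}\}$, $\hat o_R(G)=\max\{o_R(G+Y):Y\in\mathcal E\text{ a Right-end}\}$, and the strong outcome $\hat o(G)$ is the pair $(\hat o_L(G),\hat o_R(G))$ (named $\mathscr L,\mathscr N,\mathscr P,\mathscr R$ as for outcomes), ordered componentwise, i.e. $\mathscr L>\mathscr N>\mathscr R$, $\mathscr L>\mathscr P>\mathscr R$, with $\mathscr N,\mathscr P$ incomparable. -}

module Defs where

open import Data.List using (List; []; _∷_; _++_)
open import Data.List.Membership.Propositional using (_∈_)
open import Data.Product using (Σ; _×_; _,_)
open import Data.Sum using (_⊎_)
open import Relation.Binary.PropositionalEquality using (_≡_)

-- Short partizan games as finite game trees: mk (Left options) (Right options).
data Game : Set where
  mk : List Game → List Game → Game

leftOpts : Game → List Game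
leftOpts (mk gl _) = gl

rightOpts : Game → List Game
rightOpts (mk _ gr) = gr

mutual
  _⊕_ : Game → Game → Game
  mk gl gr ⊕ mk hl hr = mk (sumL gl (mk hl hr) ++ sumR (mk gl gr) hl)
                           (sumL gr (mk hl hr) ++ sumR (mk gl gr) hr)

  sumL : List Game → Game → List Game
  sumL [] H = []
  sumL (g ∷ gs) H = (g ⊕ H) ∷ sumL gs H

  sumR : Game → List Game → List Game
  sumR G [] = []
  sumR G (h ∷ hs) = (G ⊕ h) ∷ sumR G hs

data Follower : Game → Game → Set where
  self  : ∀ {G} → Follower G G
  viaL  : ∀ {F G G'} → G' ∈ leftOpts G → Follower F G' → Follower F G
  viaR  : ∀ {F G G'} → G' ∈ rightOpts G → Follower F G' → Follower F G

LeftEnd : Game → Set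
LeftEnd G = leftOpts G ≡ []

RightEnd : Game → Set
RightEnd G = rightOpts G ≡ []

DeadLeftEnd : Game → Set
DeadLeftEnd G = ∀ F → Follower F G → LeftEnd F

DeadRightEnd : Game → Set
DeadRightEnd G = ∀ F → Follower F G → RightEnd F

DeadEnding : Game → Set
DeadEnding G = ∀ F → Follower F G →
  (LeftEnd F → DeadLeftEnd F) × (RightEnd F → DeadRightEnd F)

-- Outcomes (misère play): Lw = Left wins, Rw = Right wins; Lw > Rw.
data Out : Set where
  Lw Rw : Out

data _≤O_ : Out → Out → Set where
  R≤ : ∀ {v} → Rw ≤O v
  L≤L : Lw ≤O Lw

maxO : Out → Out → Out
maxO Lw _ = Lw
maxO Rw v = v

minO : Out → Out → Out
minO Rw _ = Rw
minO Lw v = v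

mutual
  -- o_L(G): Left moves first; a player with no move wins.
  oL : Game → Out
  oL (mk [] _) = Lw
  oL (mk (g ∷ gs) _) = maxR (g ∷ gs)

  oR : Game → Out
  oR (mk _ []) = Rw
  oR (mk _ (g ∷ gs)) = minL (g ∷ gs)

  maxR : List Game → Out
  maxR [] = Rw
  maxR (g ∷ gs) = maxO (oR g) (maxR gs)

  minL : List Game → Out
  minL [] = Lw
  minL (g ∷ gs) = minO (oL g) (minL gs)

_≥E_ : Game → Game → Set
G ≥E H = ∀ X → DeadEnding X →
  (oL (H ⊕ X) ≤O oL (G ⊕ X)) × (oR (H ⊕ X) ≤O oR (G ⊕ X))

-- Strong outcomes.  ô_L(G) is the minimum of o_L(G+X) over dead-ending
-- Left-ends X, ô_R(G) the maximum of o_R(G+Y) over dead-ending Right-ends Y.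
-- We compare these extrema through their bounds (the minimum exists as the
-- index class is nonempty and outcomes form a finite chain):
--   ô_L(G) ≥ ô_L(H)  iff every lower bound of {o_L(H+X)} is a lower bound of {o_L(G+X)},
--   ô_R(G) ≥ ô_R(H)  iff every upper bound of {o_R(G+Y)} is an upper bound of {o_R(H+Y)}.
LowerBoundL : Out → Game → Set
LowerBoundL v G = ∀ X → DeadEnding X → LeftEnd X → v ≤O oL (G ⊕ X)

UpperBoundR : Out → Game → Set
UpperBoundR v G = ∀ Y → DeadEnding Y → RightEnd Y → oR (G ⊕ Y) ≤O v

hatOL-≥ : Game → Game → Set
hatOL-≥ G H = ∀ v → LowerBoundL v H → LowerBoundL v G

hatOR-≥ : Game → Game → Set
hatOR-≥ G H = ∀ v → UpperBoundR v G → UpperBoundR v H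

hatO-≥ : Game → Game → Set
hatO-≥ G H = hatOL-≥ G H × hatOR-≥ G H

Cond2 : Game → Game → Set
Cond2 G H = ∀ HL → HL ∈ leftOpts H →
  (Σ Game λ GL → GL ∈ leftOpts G × GL ≥E HL)
  ⊎ (Σ Game λ HLR → HLR ∈ rightOpts HL × G ≥E HLR)

Cond3 : Game → Game → Set
Cond3 G H = ∀ GR → GR ∈ rightOpts G →
  (Σ Game λ HR → HR ∈ rightOpts H × GR ≥E HR)
  ⊎ (Σ Game λ GRL → GRL ∈ leftOpts GR × GRL ≥E H)

module Submission where

open import Defs
open import Data.Product using (_×_; Σ; _,_; proj₁; proj₂)
open import Function.Bundles using (_⇔_; mk⇔)
open import Data.List using (List; []; _∷_; _++_; map)
open import Data.List.Membership.Propositional using (_∈_; mapWith∈)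
open import Data.List.Membership.Propositional.Properties using (∈-map⁺; ∈-map⁻; ∈-++⁺ˡ; ∈-++⁺ʳ; ∈-++⁻)
open import Data.List.Relation.Unary.Any using (here; there)
open import Data.List.Relation.Unary.Any.Properties using (mapWith∈⁺; mapWith∈⁻)
open import Data.Nat using (ℕ; zero; suc; _+_; _≤_; _<_; _⊔_; z≤n)
open import Data.Nat.Properties
  using (m≤m⊔n; m≤n⊔m; ⊔-comm; +-comm; ≤-refl; ≤-trans; ≤-total; ≤-pred; <-trans; <-≤-trans; <⇒≤; n≤1+n;
         m≤m+n; m≤n+m; m≤n⇒m<n∨m≡n; +-mono-<; +-monoʳ-<; _<?_; ≮⇒≥)
open import Data.Sum using (_⊎_; inj₁; inj₂)
open import Data.Empty using (⊥-elim)
open import Relation.Nullary using (¬_; yes; no)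
open import Relation.Binary.PropositionalEquality using (_≡_; refl; sym; trans; cong; cong₂; subst; subst₂)

-- Sufficiency of (1)-(3) is an induction on the test game X: Left's
-- wins in H + X are transferred to G + X (and Right's wins the other way) move by move,
-- (2) and (3) answering moves in H and G, the induction hypothesis moves in X, and (1)
-- the positions where the player to move has no move.  Necessity of (1) is immediate.
-- For (2) and (3) one of two alternatives must be produced constructively, so we prove
-- more: for all G, H either G ≥_𝓔 H or a dead-ending X separates them (Left, moving
-- first, wins H + X but loses G + X).  This is a recursion on depth G + depth H: if (1),
-- (2) or (3) fails we build a separating game, otherwise sufficiency applies.  The tools:
--   * integers, which burden the player holding spare moves (misère play);
--   * Right trees, dead Left-ends which realise the strong outcome ô_L(G);
--   * conjugation (Left and Right swapped), which reduces every Right-sided statement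
--     (ô_R, Condition (3), Right-first separators) to its Left-sided twin.

Lw≢Rw : ¬ (Lw ≡ Rw)
Lw≢Rw ()

opp : Out → Out
opp Lw = Rw
opp Rw = Lw

opp-Lw : ∀ {v} → opp v ≡ Lw → v ≡ Rw
opp-Lw {Rw} _ = refl

opp-minO : ∀ a b → opp (minO a b) ≡ maxO (opp a) (opp b)
opp-minO Lw b = refl
opp-minO Rw b = refl

opp-maxO : ∀ a b → opp (maxO a b) ≡ minO (opp a) (opp b)
opp-maxO Lw b = refl
opp-maxO Rw b = refl

opp-antitone : ∀ {a b} → a ≤O b → opp b ≤O opp a
opp-antitone {b = Lw} R≤ = R≤
opp-antitone {b = Rw} R≤ = L≤L
opp-antitone L≤L = R≤

≤O-fromLw : ∀ {a b} → (a ≡ Lw → b ≡ Lw) → a ≤O b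
≤O-fromLw {Lw} f with f refl
... | refl = L≤L
≤O-fromLw {Rw} f = R≤

≤O-fromRw : ∀ {a b} → (b ≡ Rw → a ≡ Rw) → a ≤O b
≤O-fromRw {b = Lw} f = ≤O-fromLw λ _ → refl
≤O-fromRw {b = Rw} f with f refl
... | refl = R≤

≤O-Lw : ∀ {a b} → a ≤O b → a ≡ Lw → b ≡ Lw
≤O-Lw L≤L refl = refl

≤O-Rw : ∀ {a b} → a ≤O b → b ≡ Rw → a ≡ Rw
≤O-Rw R≤ _ = refl

≤O-trans : ∀ {a b c} → a ≤O b → b ≤O c → a ≤O c
≤O-trans R≤ _ = R≤
≤O-trans L≤L L≤L = L≤L

≤Lw : ∀ a → a ≤O Lw
≤Lw Lw = L≤L
≤Lw Rw = R≤

maxR-Lw⁺ : ∀ {g l} → g ∈ l → oR g ≡ Lw → maxR l ≡ Lw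
maxR-Lw⁺ (here refl) e rewrite e = refl
maxR-Lw⁺ {l = x ∷ _} (there p) e with oR x
... | Lw = refl
... | Rw = maxR-Lw⁺ p e

maxR-Lw⁻ : ∀ l → maxR l ≡ Lw → Σ Game λ g → g ∈ l × oR g ≡ Lw
maxR-Lw⁻ (x ∷ xs) e with oR x in eq
... | Lw = x , here refl , eq
... | Rw with maxR-Lw⁻ xs e
...   | g , p , e' = g , there p , e'

maxR-Rw⁻ : ∀ {g l} → maxR l ≡ Rw → g ∈ l → oR g ≡ Rw
maxR-Rw⁻ {g} e p with oR g in eq
... | Rw = refl
... | Lw = ⊥-elim (Lw≢Rw (trans (sym (maxR-Lw⁺ p eq)) e))

maxR-Rw⁺ : ∀ l → (∀ g → g ∈ l → oR g ≡ Rw) → maxR l ≡ Rw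
maxR-Rw⁺ [] _ = refl
maxR-Rw⁺ (x ∷ xs) all rewrite all x (here refl) = maxR-Rw⁺ xs (λ g p → all g (there p))

minL-Rw⁺ : ∀ {g l} → g ∈ l → oL g ≡ Rw → minL l ≡ Rw
minL-Rw⁺ (here refl) e rewrite e = refl
minL-Rw⁺ {l = x ∷ _} (there p) e with oL x
... | Rw = refl
... | Lw = minL-Rw⁺ p e

minL-Rw⁻ : ∀ l → minL l ≡ Rw → Σ Game λ g → g ∈ l × oL g ≡ Rw
minL-Rw⁻ (x ∷ xs) e with oL x in eq
... | Rw = x , here refl , eq
... | Lw with minL-Rw⁻ xs e
...   | g , p , e' = g , there p , e'

minL-Lw⁻ : ∀ {g l} → minL l ≡ Lw → g ∈ l → oL g ≡ Lw
minL-Lw⁻ {g} e p with oL g in eq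
... | Lw = refl
... | Rw = ⊥-elim (Lw≢Rw (trans (sym e) (minL-Rw⁺ p eq)))

minL-Lw⁺ : ∀ l → (∀ g → g ∈ l → oL g ≡ Lw) → minL l ≡ Lw
minL-Lw⁺ [] _ = refl
minL-Lw⁺ (x ∷ xs) all rewrite all x (here refl) = minL-Lw⁺ xs (λ g p → all g (there p))

nonEmpty : ∀ {A : Set} {x : A} {l} → x ∈ l → ¬ (l ≡ [])
nonEmpty (here _) ()
nonEmpty (there _) ()

emptyOrMember : ∀ {A : Set} (l : List A) → l ≡ [] ⊎ Σ A (_∈ l)
emptyOrMember [] = inj₁ refl
emptyOrMember (x ∷ _) = inj₂ (x , here refl)

oL-Lw-end : ∀ G → LeftEnd G → oL G ≡ Lw
oL-Lw-end (mk [] _) _ = refl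

oL-Lw-move : ∀ {g} G → g ∈ leftOpts G → oR g ≡ Lw → oL G ≡ Lw
oL-Lw-move (mk (_ ∷ _) _) = maxR-Lw⁺

oL-Lw⁻ : ∀ G → oL G ≡ Lw → LeftEnd G ⊎ (Σ Game λ g → g ∈ leftOpts G × oR g ≡ Lw)
oL-Lw⁻ (mk [] _) _ = inj₁ refl
oL-Lw⁻ (mk (x ∷ xs) _) e = inj₂ (maxR-Lw⁻ (x ∷ xs) e)

oL-Rw⁺ : ∀ G → ¬ LeftEnd G → (∀ g → g ∈ leftOpts G → oR g ≡ Rw) → oL G ≡ Rw
oL-Rw⁺ (mk [] _) notEnd _ = ⊥-elim (notEnd refl)
oL-Rw⁺ (mk (x ∷ xs) _) _ = maxR-Rw⁺ (x ∷ xs)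

oL-Rw⁻ : ∀ {g} G → oL G ≡ Rw → g ∈ leftOpts G → oR g ≡ Rw
oL-Rw⁻ (mk (_ ∷ _) _) = maxR-Rw⁻

oR-Rw-end : ∀ G → RightEnd G → oR G ≡ Rw
oR-Rw-end (mk _ []) _ = refl

oR-Rw-move : ∀ {g} G → g ∈ rightOpts G → oL g ≡ Rw → oR G ≡ Rw
oR-Rw-move (mk _ (_ ∷ _)) = minL-Rw⁺

oR-Rw⁻ : ∀ G → oR G ≡ Rw → RightEnd G ⊎ (Σ Game λ g → g ∈ rightOpts G × oL g ≡ Rw)
oR-Rw⁻ (mk _ []) _ = inj₁ refl
oR-Rw⁻ (mk _ (x ∷ xs)) e = inj₂ (minL-Rw⁻ (x ∷ xs) e)

oR-Lw⁺ : ∀ G → ¬ RightEnd G → (∀ g → g ∈ rightOpts G → oL g ≡ Lw) → oR G ≡ Lw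
oR-Lw⁺ (mk _ []) notEnd _ = ⊥-elim (notEnd refl)
oR-Lw⁺ (mk _ (x ∷ xs)) _ = minL-Lw⁺ (x ∷ xs)

oR-Lw⁻ : ∀ {g} G → oR G ≡ Lw → g ∈ rightOpts G → oL g ≡ Lw
oR-Lw⁻ (mk _ (_ ∷ _)) = minL-Lw⁻

sumL≡map : ∀ gs H → sumL gs H ≡ map (_⊕ H) gs
sumL≡map [] H = refl
sumL≡map (g ∷ gs) H = cong (g ⊕ H ∷_) (sumL≡map gs H)

sumR≡map : ∀ G hs → sumR G hs ≡ map (G ⊕_) hs
sumR≡map G [] = refl
sumR≡map G (h ∷ hs) = cong (G ⊕ h ∷_) (sumR≡map G hs)

⊕-leftOpts : ∀ G X → leftOpts (G ⊕ X) ≡ map (_⊕ X) (leftOpts G) ++ map (G ⊕_) (leftOpts X)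
⊕-leftOpts (mk gl gr) (mk xl xr) = cong₂ _++_ (sumL≡map gl (mk xl xr)) (sumR≡map (mk gl gr) xl)

⊕-rightOpts : ∀ G X → rightOpts (G ⊕ X) ≡ map (_⊕ X) (rightOpts G) ++ map (G ⊕_) (rightOpts X)
⊕-rightOpts (mk gl gr) (mk xl xr) = cong₂ _++_ (sumL≡map gr (mk xl xr)) (sumR≡map (mk gl gr) xr)

⊕-leftOpt₁ : ∀ {g} G X → g ∈ leftOpts G → (g ⊕ X) ∈ leftOpts (G ⊕ X)
⊕-leftOpt₁ G X p = subst (_ ∈_) (sym (⊕-leftOpts G X)) (∈-++⁺ˡ (∈-map⁺ (_⊕ X) p))

⊕-leftOpt₂ : ∀ {x} G X → x ∈ leftOpts X → (G ⊕ x) ∈ leftOpts (G ⊕ X)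
⊕-leftOpt₂ G X p = subst (_ ∈_) (sym (⊕-leftOpts G X)) (∈-++⁺ʳ _ (∈-map⁺ (G ⊕_) p))

⊕-rightOpt₁ : ∀ {g} G X → g ∈ rightOpts G → (g ⊕ X) ∈ rightOpts (G ⊕ X)
⊕-rightOpt₁ G X p = subst (_ ∈_) (sym (⊕-rightOpts G X)) (∈-++⁺ˡ (∈-map⁺ (_⊕ X) p))

⊕-rightOpt₂ : ∀ {x} G X → x ∈ rightOpts X → (G ⊕ x) ∈ rightOpts (G ⊕ X)
⊕-rightOpt₂ G X p = subst (_ ∈_) (sym (⊕-rightOpts G X)) (∈-++⁺ʳ _ (∈-map⁺ (G ⊕_) p))

SumOption : (Game → List Game) → Game → Game → Game → Set
SumOption opts G X y = (Σ Game λ g → g ∈ opts G × y ≡ g ⊕ X) ⊎ (Σ Game λ x → x ∈ opts X × y ≡ G ⊕ x)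

⊕-leftOpt⁻ : ∀ {y} G X → y ∈ leftOpts (G ⊕ X) → SumOption leftOpts G X y
⊕-leftOpt⁻ G X p with ∈-++⁻ _ (subst (_ ∈_) (⊕-leftOpts G X) p)
... | inj₁ q = inj₁ (∈-map⁻ (_⊕ X) q)
... | inj₂ q = inj₂ (∈-map⁻ (G ⊕_) q)

⊕-rightOpt⁻ : ∀ {y} G X → y ∈ rightOpts (G ⊕ X) → SumOption rightOpts G X y
⊕-rightOpt⁻ G X p with ∈-++⁻ _ (subst (_ ∈_) (⊕-rightOpts G X) p)
... | inj₁ q = inj₁ (∈-map⁻ (_⊕ X) q)
... | inj₂ q = inj₂ (∈-map⁻ (G ⊕_) q)

⊕-LeftEnd : ∀ G X → LeftEnd G → LeftEnd X → LeftEnd (G ⊕ X)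
⊕-LeftEnd (mk [] _) (mk [] _) refl refl = refl

⊕-RightEnd : ∀ G X → RightEnd G → RightEnd X → RightEnd (G ⊕ X)
⊕-RightEnd (mk _ []) (mk _ []) refl refl = refl

⊕-LeftEnd⁻ : ∀ G X → LeftEnd (G ⊕ X) → LeftEnd G × LeftEnd X
⊕-LeftEnd⁻ (mk [] _) (mk [] _) _ = refl , refl

⊕-RightEnd⁻ : ∀ G X → RightEnd (G ⊕ X) → RightEnd G × RightEnd X
⊕-RightEnd⁻ (mk _ []) (mk _ []) _ = refl , refl

InductiveStep : (Game → Set) → Set
InductiveStep P = ∀ G → (∀ g → g ∈ leftOpts G → P g) → (∀ g → g ∈ rightOpts G → P g) → P G

mutual
  Game-ind : (P : Game → Set) → InductiveStep P → ∀ G → P G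
  Game-ind P step (mk l r) = step (mk l r) (options-ind P step l) (options-ind P step r)

  options-ind : (P : Game → Set) → InductiveStep P → ∀ l g → g ∈ l → P g
  options-ind P step (x ∷ _) g (here refl) = Game-ind P step x
  options-ind P step (_ ∷ xs) g (there p) = options-ind P step xs g p

mutual
  depth : Game → ℕ
  depth (mk l r) = depthL l ⊔ depthL r

  depthL : List Game → ℕ
  depthL [] = 0
  depthL (g ∷ gs) = suc (depth g) ⊔ depthL gs

depthL-∈ : ∀ {g l} → g ∈ l → depth g < depthL l
depthL-∈ {l = x ∷ xs} (here refl) = m≤m⊔n (suc (depth x)) (depthL xs)
depthL-∈ {l = x ∷ xs} (there p) = ≤-trans (depthL-∈ p) (m≤n⊔m (suc (depth x)) (depthL xs))

depth-leftOpt : ∀ {g} G → g ∈ leftOpts G → depth g < depth G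
depth-leftOpt (mk l r) p = ≤-trans (depthL-∈ p) (m≤m⊔n (depthL l) (depthL r))

depth-rightOpt : ∀ {g} G → g ∈ rightOpts G → depth g < depth G
depth-rightOpt (mk l r) p = ≤-trans (depthL-∈ p) (m≤n⊔m (depthL l) (depthL r))

follower-trans : ∀ {F G' G} → Follower F G' → Follower G' G → Follower F G
follower-trans f self = f
follower-trans f (viaL p q) = viaL p (follower-trans f q)
follower-trans f (viaR p q) = viaR p (follower-trans f q)

deadEnding-leftOpt : ∀ {G g} → DeadEnding G → g ∈ leftOpts G → DeadEnding g
deadEnding-leftOpt d p F f = d F (viaL p f)

deadEnding-rightOpt : ∀ {G g} → DeadEnding G → g ∈ rightOpts G → DeadEnding g
deadEnding-rightOpt d p F f = d F (viaR p f)

deadEnding-LeftEnd : ∀ {X} → DeadEnding X → LeftEnd X → DeadLeftEnd X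
deadEnding-LeftEnd {X} d = proj₁ (d X self)

zero-game : ∀ F → LeftEnd F → RightEnd F → F ≡ mk [] []
zero-game (mk [] []) refl refl = refl

zero-followers : ∀ {F} → Follower F (mk [] []) → LeftEnd F × RightEnd F
zero-followers self = refl , refl

-- Dead Left-ends and dead Right-ends are dead-ending: a follower that is an end
-- of the other kind as well is zero.
deadLeftEnd⇒deadEnding : ∀ {X} → DeadLeftEnd X → DeadEnding X
deadLeftEnd⇒deadEnding dead F f =
  (λ _ F' f' → dead F' (follower-trans f' f)) ,
  (λ re F' f' → proj₂ (zero-followers (subst (Follower F') (zero-game F (dead F f) re) f')))

deadRightEnd⇒deadEnding : ∀ {X} → DeadRightEnd X → DeadEnding X
deadRightEnd⇒deadEnding dead F f =
  (λ le F' f' → proj₁ (zero-followers (subst (Follower F') (zero-game F le (dead F f)) f'))) ,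
  (λ _ F' f' → dead F' (follower-trans f' f))

-- A game with Left and Right options, all dead-ending, is dead-ending
-- (it is neither a Left-end nor a Right-end itself).
deadEnding-mk : ∀ {a as b bs} → (∀ g → g ∈ (a ∷ as) → DeadEnding g) →
  (∀ g → g ∈ (b ∷ bs) → DeadEnding g) → DeadEnding (mk (a ∷ as) (b ∷ bs))
deadEnding-mk dl dr F self = (λ ()) , (λ ())
deadEnding-mk dl dr F (viaL p f) = dl _ p F f
deadEnding-mk dl dr F (viaR p f) = dr _ p F f

mutual
  conj : Game → Game
  conj (mk l r) = mk (conjs r) (conjs l)

  conjs : List Game → List Game
  conjs [] = []
  conjs (g ∷ gs) = conj g ∷ conjs gs

mutual
  conj-invol : ∀ G → conj (conj G) ≡ G
  conj-invol (mk l r) = cong₂ mk (conjs-invol l) (conjs-invol r)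

  conjs-invol : ∀ l → conjs (conjs l) ≡ l
  conjs-invol [] = refl
  conjs-invol (g ∷ gs) = cong₂ _∷_ (conj-invol g) (conjs-invol gs)

conjs-∈ : ∀ {g l} → g ∈ l → conj g ∈ conjs l
conjs-∈ (here refl) = here refl
conjs-∈ (there p) = there (conjs-∈ p)

conjs-∈⁻ : ∀ {y} l → y ∈ conjs l → Σ Game λ g → g ∈ l × y ≡ conj g
conjs-∈⁻ (g ∷ _) (here e) = g , here refl , e
conjs-∈⁻ (_ ∷ gs) (there p) with conjs-∈⁻ gs p
... | g , q , e = g , there q , e

conjs-++ : ∀ l m → conjs (l ++ m) ≡ conjs l ++ conjs m
conjs-++ [] m = refl
conjs-++ (g ∷ l) m = cong (conj g ∷_) (conjs-++ l m)

leftOpt-conj : ∀ {g} G → g ∈ rightOpts G → conj g ∈ leftOpts (conj G)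
leftOpt-conj (mk _ _) = conjs-∈

rightOpt-conj : ∀ {g} G → g ∈ leftOpts G → conj g ∈ rightOpts (conj G)
rightOpt-conj (mk _ _) = conjs-∈

leftOpt-conj⁻ : ∀ {y} G → y ∈ leftOpts (conj G) → Σ Game λ g → g ∈ rightOpts G × y ≡ conj g
leftOpt-conj⁻ (mk _ r) = conjs-∈⁻ r

rightOpt-conj⁻ : ∀ {y} G → y ∈ rightOpts (conj G) → Σ Game λ g → g ∈ leftOpts G × y ≡ conj g
rightOpt-conj⁻ (mk l _) = conjs-∈⁻ l

LeftEnd-conj : ∀ G → RightEnd G → LeftEnd (conj G)
LeftEnd-conj (mk _ []) refl = refl

RightEnd-conj : ∀ G → LeftEnd G → RightEnd (conj G)
RightEnd-conj (mk [] _) refl = refl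

LeftEnd-conj⁻ : ∀ G → RightEnd (conj G) → LeftEnd G
LeftEnd-conj⁻ (mk [] _) _ = refl

RightEnd-conj⁻ : ∀ G → LeftEnd (conj G) → RightEnd G
RightEnd-conj⁻ (mk _ []) _ = refl

mutual
  conj-⊕ : ∀ G H → conj (G ⊕ H) ≡ conj G ⊕ conj H
  conj-⊕ (mk gl gr) (mk hl hr) = cong₂ mk
    (trans (conjs-++ (sumL gr _) _) (cong₂ _++_ (conjs-sumL gr (mk hl hr)) (conjs-sumR (mk gl gr) hr)))
    (trans (conjs-++ (sumL gl _) _) (cong₂ _++_ (conjs-sumL gl (mk hl hr)) (conjs-sumR (mk gl gr) hl)))

  conjs-sumL : ∀ gs H → conjs (sumL gs H) ≡ sumL (conjs gs) (conj H)
  conjs-sumL [] H = refl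
  conjs-sumL (g ∷ gs) H = cong₂ _∷_ (conj-⊕ g H) (conjs-sumL gs H)

  conjs-sumR : ∀ G hs → conjs (sumR G hs) ≡ sumR (conj G) (conjs hs)
  conjs-sumR G [] = refl
  conjs-sumR G (h ∷ hs) = cong₂ _∷_ (conj-⊕ G h) (conjs-sumR G hs)

mutual
  depth-conj : ∀ G → depth (conj G) ≡ depth G
  depth-conj (mk l r) = trans (cong₂ _⊔_ (depthL-conjs r) (depthL-conjs l)) (⊔-comm (depthL r) (depthL l))

  depthL-conjs : ∀ l → depthL (conjs l) ≡ depthL l
  depthL-conjs [] = refl
  depthL-conjs (g ∷ gs) = cong₂ (λ a b → suc a ⊔ b) (depth-conj g) (depthL-conjs gs)

mutual
  oL-conj : ∀ G → oL (conj G) ≡ opp (oR G)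
  oL-conj (mk _ []) = refl
  oL-conj (mk _ (g ∷ gs)) = maxR-conjs (g ∷ gs)

  oR-conj : ∀ G → oR (conj G) ≡ opp (oL G)
  oR-conj (mk [] _) = refl
  oR-conj (mk (g ∷ gs) _) = minL-conjs (g ∷ gs)

  maxR-conjs : ∀ l → maxR (conjs l) ≡ opp (minL l)
  maxR-conjs [] = refl
  maxR-conjs (g ∷ gs) = trans (cong₂ maxO (oR-conj g) (maxR-conjs gs)) (sym (opp-minO (oL g) (minL gs)))

  minL-conjs : ∀ l → minL (conjs l) ≡ opp (maxR l)
  minL-conjs [] = refl
  minL-conjs (g ∷ gs) = trans (cong₂ minO (oL-conj g) (minL-conjs gs)) (sym (opp-maxO (oR g) (maxR gs)))

oL-conj-⊕ : ∀ G X → oL (conj G ⊕ conj X) ≡ opp (oR (G ⊕ X))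
oL-conj-⊕ G X = trans (cong oL (sym (conj-⊕ G X))) (oL-conj (G ⊕ X))

oR-conj-⊕ : ∀ G X → oR (conj G ⊕ conj X) ≡ opp (oL (G ⊕ X))
oR-conj-⊕ G X = trans (cong oR (sym (conj-⊕ G X))) (oR-conj (G ⊕ X))

oL-⊕-conj : ∀ G X → oL (G ⊕ conj X) ≡ opp (oR (conj G ⊕ X))
oL-⊕-conj G X = subst (λ G' → oL (G' ⊕ conj X) ≡ opp (oR (conj G ⊕ X))) (conj-invol G) (oL-conj-⊕ (conj G) X)

oR-⊕-conj : ∀ G X → oR (G ⊕ conj X) ≡ opp (oL (conj G ⊕ X))
oR-⊕-conj G X = subst (λ G' → oR (G' ⊕ conj X) ≡ opp (oL (conj G ⊕ X))) (conj-invol G) (oR-conj-⊕ (conj G) X)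

follower-conj : ∀ {F G} → Follower F G → Follower (conj F) (conj G)
follower-conj self = self
follower-conj {G = G} (viaL p f) = viaR (rightOpt-conj G p) (follower-conj f)
follower-conj {G = G} (viaR p f) = viaL (leftOpt-conj G p) (follower-conj f)

deadEnding-conj : ∀ {X} → DeadEnding X → DeadEnding (conj X)
deadEnding-conj {X} d F f = deadLeft , deadRight
  where
  f' : Follower (conj F) X
  f' = subst (Follower (conj F)) (conj-invol X) (follower-conj f)
  deadLeft : LeftEnd F → DeadLeftEnd F
  deadLeft le F' g = LeftEnd-conj⁻ F' (proj₂ (d (conj F) f') (RightEnd-conj F le) (conj F') (follower-conj g))
  deadRight : RightEnd F → DeadRightEnd F
  deadRight re F' g = RightEnd-conj⁻ F' (proj₁ (d (conj F) f') (LeftEnd-conj F re) (conj F') (follower-conj g))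

int : ℕ → Game
int zero = mk [] []
int (suc n) = mk (int n ∷ []) []

negInt : ℕ → Game
negInt n = conj (int n)

int-deadRightEnd : ∀ n → DeadRightEnd (int n)
int-deadRightEnd zero _ self = refl
int-deadRightEnd (suc n) _ self = refl
int-deadRightEnd (suc n) F (viaL (here refl) f) = int-deadRightEnd n F f

-- In misère play spare moves are a burden: with at least depth A moves in reserve
-- Left loses A ⊕ int n when Right starts, and with more than depth A moves even
-- when she starts herself.
IntLoses : Game → Set
IntLoses A = (∀ n → depth A ≤ n → oR (A ⊕ int n) ≡ Rw) × (∀ n → depth A < n → oL (A ⊕ int n) ≡ Rw)

int-loses : ∀ A → IntLoses A
int-loses = Game-ind IntLoses step
  where
  step : InductiveStep IntLoses
  step G ihL ihR = rightFirst , leftFirst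
    where
    rightFirst : ∀ n → depth G ≤ n → oR (G ⊕ int n) ≡ Rw
    rightFirst n le with emptyOrMember (rightOpts G)
    ... | inj₁ end = oR-Rw-end (G ⊕ int n) (⊕-RightEnd G (int n) end (int-deadRightEnd n _ self))
    ... | inj₂ (g , p) = oR-Rw-move (G ⊕ int n) (⊕-rightOpt₁ G (int n) p)
                           (proj₂ (ihR g p) n (<-≤-trans (depth-rightOpt G p) le))
    leftFirst : ∀ n → depth G < n → oL (G ⊕ int n) ≡ Rw
    leftFirst (suc k) lt = oL-Rw⁺ (G ⊕ int (suc k)) (nonEmpty (⊕-leftOpt₂ G (int (suc k)) (here refl))) reply
      where
      reply : ∀ y → y ∈ leftOpts (G ⊕ int (suc k)) → oR y ≡ Rw
      reply y p with ⊕-leftOpt⁻ G (int (suc k)) p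
      ... | inj₁ (g , q , refl) = proj₁ (ihL g q) (suc k) (<⇒≤ (<-trans (depth-leftOpt G q) lt))
      ... | inj₂ (_ , here refl , refl) = rightFirst k (≤-pred lt)

negInt-wins : ∀ A → (∀ n → depth A ≤ n → oL (A ⊕ negInt n) ≡ Lw) × (∀ n → depth A < n → oR (A ⊕ negInt n) ≡ Lw)
negInt-wins A =
  (λ n le → trans (oL-⊕-conj A (int n)) (cong opp (proj₁ (int-loses (conj A)) n (subst (_≤ n) (sym (depth-conj A)) le)))) ,
  (λ n lt → trans (oR-⊕-conj A (int n)) (cong opp (proj₂ (int-loses (conj A)) n (subst (_< n) (sym (depth-conj A)) lt))))

-- Right trees.  rightTree k is a dead Left-end in which Right may move to any
-- rightTree m with m < k; among dead Left-ends of depth k it is the best for Right.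

rightTree : ℕ → Game
rightTree zero = mk [] []
rightTree (suc k) = mk [] (rightTree k ∷ rightOpts (rightTree k))

rightTree-LeftEnd : ∀ k → LeftEnd (rightTree k)
rightTree-LeftEnd zero = refl
rightTree-LeftEnd (suc k) = refl

rightTree-∈ : ∀ {m k} → m < k → rightTree m ∈ rightOpts (rightTree k)
rightTree-∈ {m} {suc k} lt with m≤n⇒m<n∨m≡n (≤-pred lt)
... | inj₁ m<k = there (rightTree-∈ m<k)
... | inj₂ refl = here refl

rightTree-∈⁻ : ∀ {x} k → x ∈ rightOpts (rightTree k) → Σ ℕ λ m → m < k × x ≡ rightTree m
rightTree-∈⁻ (suc k) (here e) = k , ≤-refl , e
rightTree-∈⁻ (suc k) (there p) with rightTree-∈⁻ k p
... | m , lt , e = m , <-trans lt ≤-refl , e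

rightTree-deadLeftEnd : ∀ k → DeadLeftEnd (rightTree k)
rightTree-deadLeftEnd k _ self = rightTree-LeftEnd k
rightTree-deadLeftEnd k F (viaL p _) = ⊥-elim (nonEmpty p (rightTree-LeftEnd k))
rightTree-deadLeftEnd k F (viaR p f) with rightTree-∈⁻ k p
... | m , _ , refl = rightTree-deadLeftEnd m F f

-- Right's moves in x are
-- matched by moves to smaller Right trees; Left never moves in either.
Simulated : Game → Game → Set
Simulated G x = (oL (G ⊕ rightTree (depth x)) ≡ Lw → oL (G ⊕ x) ≡ Lw)
              × (oR (G ⊕ rightTree (depth x)) ≡ Lw → oR (G ⊕ x) ≡ Lw)

rightTree-simulates : ∀ G x → DeadLeftEnd x → Simulated G x
rightTree-simulates = Game-ind (λ G → ∀ x → DeadLeftEnd x → Simulated G x) stepG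
  where
  stepG : InductiveStep (λ G → ∀ x → DeadLeftEnd x → Simulated G x)
  stepG G ihGL ihGR = Game-ind (λ x → DeadLeftEnd x → Simulated G x) stepX
    where
    stepX : InductiveStep (λ x → DeadLeftEnd x → Simulated G x)
    stepX x _ ihx dead = leftFirst , rightFirst
      where
      T : Game
      T = rightTree (depth x)
      leftFirst : oL (G ⊕ T) ≡ Lw → oL (G ⊕ x) ≡ Lw
      leftFirst e with oL-Lw⁻ (G ⊕ T) e
      ... | inj₁ end = oL-Lw-end (G ⊕ x) (⊕-LeftEnd G x (proj₁ (⊕-LeftEnd⁻ G T end)) (dead x self))
      ... | inj₂ (y , p , e') with ⊕-leftOpt⁻ G T p
      ...   | inj₁ (g , q , refl) = oL-Lw-move (G ⊕ x) (⊕-leftOpt₁ G x q) (proj₂ (ihGL g q x dead) e')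
      ...   | inj₂ (_ , q , _) = ⊥-elim (nonEmpty q (rightTree-LeftEnd (depth x)))
      rightFirst : oR (G ⊕ T) ≡ Lw → oR (G ⊕ x) ≡ Lw
      rightFirst e = oR-Lw⁺ (G ⊕ x) notEnd reply
        where
        -- If Right had no move in G ⊕ x, x would be zero, hence T = x, and Right would win.
        notEnd : ¬ RightEnd (G ⊕ x)
        notEnd end with ⊕-RightEnd⁻ G x end
        ... | Gend , xend = Lw≢Rw (trans (sym e₀) (oR-Rw-end (G ⊕ mk [] []) (⊕-RightEnd G (mk [] []) Gend refl)))
          where
          e₀ : oR (G ⊕ mk [] []) ≡ Lw
          e₀ = subst (λ z → oR (G ⊕ rightTree (depth z)) ≡ Lw) (zero-game x (dead x self) xend) e
        reply : ∀ y → y ∈ rightOpts (G ⊕ x) → oL y ≡ Lw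
        reply y p with ⊕-rightOpt⁻ G x p
        ... | inj₁ (g , q , refl) = proj₁ (ihGR g q x dead) (oR-Lw⁻ (G ⊕ T) e (⊕-rightOpt₁ G T q))
        ... | inj₂ (c , q , refl) = proj₁ (ihx c q (λ F f → dead F (viaR q f)))
                (oR-Lw⁻ (G ⊕ T) e (⊕-rightOpt₂ G T (rightTree-∈ (depth-rightOpt x q))))

Stable : Game → Set
Stable G = (∀ k k' → depth G ≤ k → depth G ≤ k' → oL (G ⊕ rightTree k) ≡ Lw → oL (G ⊕ rightTree k') ≡ Lw)
         × (∀ k k' → depth G < k → depth G < k' → oR (G ⊕ rightTree k) ≡ Lw → oR (G ⊕ rightTree k') ≡ Lw)

rightTree-stable : ∀ G → Stable G
rightTree-stable = Game-ind Stable step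
  where
  step : InductiveStep Stable
  step G ihL ihR = leftFirst , rightFirst
    where
    leftFirst : ∀ k k' → depth G ≤ k → depth G ≤ k' → oL (G ⊕ rightTree k) ≡ Lw → oL (G ⊕ rightTree k') ≡ Lw
    leftFirst k k' le le' e with oL-Lw⁻ (G ⊕ rightTree k) e
    ... | inj₁ end = oL-Lw-end (G ⊕ rightTree k')
            (⊕-LeftEnd G (rightTree k') (proj₁ (⊕-LeftEnd⁻ G (rightTree k) end)) (rightTree-LeftEnd k'))
    ... | inj₂ (y , p , e') with ⊕-leftOpt⁻ G (rightTree k) p
    ...   | inj₁ (g , q , refl) = oL-Lw-move (G ⊕ rightTree k') (⊕-leftOpt₁ G (rightTree k') q)
              (proj₂ (ihL g q) k k' (<-≤-trans (depth-leftOpt G q) le) (<-≤-trans (depth-leftOpt G q) le') e')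
    ...   | inj₂ (_ , q , _) = ⊥-elim (nonEmpty q (rightTree-LeftEnd k))
    -- Right's move to rightTree m is answered as in rightTree (suc i): directly if m ≤ i,
    -- and through the Left-first part (comparing rightTree i with rightTree m) otherwise.
    rightFirst : ∀ k k' → depth G < k → depth G < k' → oR (G ⊕ rightTree k) ≡ Lw → oR (G ⊕ rightTree k') ≡ Lw
    rightFirst (suc i) (suc j) lt lt' e =
      oR-Lw⁺ (G ⊕ rightTree (suc j)) (nonEmpty (⊕-rightOpt₂ G (rightTree (suc j)) (here refl))) reply
      where
      reply : ∀ y → y ∈ rightOpts (G ⊕ rightTree (suc j)) → oL y ≡ Lw
      reply y p with ⊕-rightOpt⁻ G (rightTree (suc j)) p
      ... | inj₁ (g , q , refl) = proj₁ (ihR g q) (suc i) (suc j)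
              (<⇒≤ (<-trans (depth-rightOpt G q) lt)) (<⇒≤ (<-trans (depth-rightOpt G q) lt'))
              (oR-Lw⁻ (G ⊕ rightTree (suc i)) e (⊕-rightOpt₁ G (rightTree (suc i)) q))
      ... | inj₂ (_ , q , refl) with rightTree-∈⁻ (suc j) q
      ...   | m , _ , refl with m <? suc i
      ...     | yes m<k = oR-Lw⁻ (G ⊕ rightTree (suc i)) e (⊕-rightOpt₂ G (rightTree (suc i)) (rightTree-∈ m<k))
      ...     | no m≮k = leftFirst i m (≤-pred lt) (≤-trans (≤-pred lt) (≤-trans (n≤1+n i) (≮⇒≥ m≮k)))
                  (oR-Lw⁻ (G ⊕ rightTree (suc i)) e (⊕-rightOpt₂ G (rightTree (suc i)) (here refl)))

boundedSearch : (f : ℕ → Out) → ∀ m → (∀ k → k ≤ m → f k ≡ Lw) ⊎ (Σ ℕ λ k → f k ≡ Rw)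
boundedSearch f m with f m in eq
... | Rw = inj₂ (m , eq)
boundedSearch f zero | Lw = inj₁ λ { .zero z≤n → eq }
boundedSearch f (suc m) | Lw with boundedSearch f m
... | inj₂ w = inj₂ w
... | inj₁ below = inj₁ extend
  where
  extend : ∀ k → k ≤ suc m → f k ≡ Lw
  extend k le with m≤n⇒m<n∨m≡n le
  ... | inj₁ lt = below k (≤-pred lt)
  ... | inj₂ refl = eq

StrongL : Game → Set
StrongL G = (∀ X → DeadEnding X → LeftEnd X → oL (G ⊕ X) ≡ Lw)
          ⊎ (Σ Game λ X → DeadEnding X × LeftEnd X × oL (G ⊕ X) ≡ Rw)

StrongR : Game → Set
StrongR G = (∀ Y → DeadEnding Y → RightEnd Y → oR (G ⊕ Y) ≡ Rw)
          ⊎ (Σ Game λ Y → DeadEnding Y × RightEnd Y × oR (G ⊕ Y) ≡ Lw)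

-- Only the Right trees of height ≤ depth G need to be tried: taller ones behave like
-- rightTree (depth G) by stability, and every dead Left-end is simulated by one of them.
strongL : ∀ G → StrongL G
strongL G with boundedSearch (λ k → oL (G ⊕ rightTree k)) (depth G)
... | inj₂ (k , e) = inj₂ (rightTree k , deadLeftEnd⇒deadEnding (rightTree-deadLeftEnd k) , rightTree-LeftEnd k , e)
... | inj₁ low = inj₁ λ X d le → proj₁ (rightTree-simulates G X (deadEnding-LeftEnd d le)) (everyHeight (depth X))
  where
  everyHeight : ∀ k → oL (G ⊕ rightTree k) ≡ Lw
  everyHeight k with ≤-total k (depth G)
  ... | inj₁ k≤ = low k k≤
  ... | inj₂ ≤k = proj₁ (rightTree-stable G) (depth G) k ≤-refl ≤k (low (depth G) ≤-refl)

strongR : ∀ G → StrongR G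
strongR G with strongL (conj G)
... | inj₁ all = inj₁ λ Y d re →
        opp-Lw (trans (sym (oL-conj-⊕ G Y)) (all (conj Y) (deadEnding-conj d) (LeftEnd-conj Y re)))
... | inj₂ (X , d , le , e) =
        inj₂ (conj X , deadEnding-conj d , RightEnd-conj X le , trans (oR-⊕-conj G X) (cong opp e))

Compare : Game → Game → Game → Set
Compare G H X = (oL (H ⊕ X) ≤O oL (G ⊕ X)) × (oR (H ⊕ X) ≤O oR (G ⊕ X))

compare-conj : ∀ G H X → Compare G H X → Compare (conj H) (conj G) (conj X)
compare-conj G H X (leftFirst , rightFirst) =
  subst₂ _≤O_ (sym (oL-conj-⊕ G X)) (sym (oL-conj-⊕ H X)) (opp-antitone rightFirst) ,
  subst₂ _≤O_ (sym (oR-conj-⊕ G X)) (sym (oR-conj-⊕ H X)) (opp-antitone leftFirst)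

≥E-conj : ∀ G H → G ≥E H → conj H ≥E conj G
≥E-conj G H ge X d =
  subst (Compare (conj H) (conj G)) (conj-invol X) (compare-conj G H (conj X) (ge (conj X) (deadEnding-conj d)))

≥E-conj⁻ : ∀ G H → conj G ≥E conj H → H ≥E G
≥E-conj⁻ G H ge = subst₂ _≥E_ (conj-invol H) (conj-invol G) (≥E-conj (conj G) (conj H) ge)

record SepL (G H : Game) : Set where
  constructor sepL
  field
    test : Game
    test-dead : DeadEnding test
    leftWinsH : oL (H ⊕ test) ≡ Lw
    leftLosesG : oL (G ⊕ test) ≡ Rw

record SepR (G H : Game) : Set where
  constructor sepR
  field
    test : Game
    test-dead : DeadEnding test
    leftWinsH : oR (H ⊕ test) ≡ Lw
    leftLosesG : oR (G ⊕ test) ≡ Rw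

sepL-refutes : ∀ {G H} → SepL G H → ¬ (G ≥E H)
sepL-refutes (sepL X d eH eG) ge = Lw≢Rw (trans (sym (≤O-Lw (proj₁ (ge X d)) eH)) eG)

sepL-conj : ∀ {G H} → SepL G H → SepR (conj H) (conj G)
sepL-conj {G} {H} (sepL X d eH eG) =
  sepR (conj X) (deadEnding-conj d) (trans (oR-conj-⊕ G X) (cong opp eG)) (trans (oR-conj-⊕ H X) (cong opp eH))

-- A Right-first separator X yields a Left-first one: Left may move to X (reaching the
-- Right-first position), while every Left move in G is punished by Right moving to
-- the integer depth G, which leaves Left with too many moves.
sepR⇒sepL : ∀ {G H} → SepR G H → SepL G H
sepR⇒sepL {G} {H} (sepR X d eH eG) = sepL X' dead' leftWinsH leftLosesG
  where
  n : ℕ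
  n = depth G
  X' : Game
  X' = mk (X ∷ []) (int n ∷ [])
  dead' : DeadEnding X'
  dead' = deadEnding-mk (λ { _ (here refl) → d ; _ (there ()) })
                        (λ { _ (here refl) → deadRightEnd⇒deadEnding (int-deadRightEnd n) ; _ (there ()) })
  leftWinsH : oL (H ⊕ X') ≡ Lw
  leftWinsH = oL-Lw-move (H ⊕ X') (⊕-leftOpt₂ H X' (here refl)) eH
  leftLosesG : oL (G ⊕ X') ≡ Rw
  leftLosesG = oL-Rw⁺ (G ⊕ X') (nonEmpty (⊕-leftOpt₂ G X' (here refl))) reply
    where
    reply : ∀ y → y ∈ leftOpts (G ⊕ X') → oR y ≡ Rw
    reply y p with ⊕-leftOpt⁻ G X' p
    ... | inj₁ (g , q , refl) = oR-Rw-move (g ⊕ X') (⊕-rightOpt₂ g X' (here refl))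
                                  (proj₂ (int-loses g) n (depth-leftOpt G q))
    ... | inj₂ (_ , here refl , refl) = eG

sepL⇒sepR : ∀ {G H} → SepL G H → SepR G H
sepL⇒sepR {G} {H} w = subst₂ SepR (conj-invol G) (conj-invol H) (sepL-conj (sepR⇒sepL (sepL-conj w)))

sufficient : ∀ G H → hatO-≥ G H → Cond2 G H → Cond3 G H → G ≥E H
sufficient G H (hatL , hatR) cond2 cond3 = Game-ind (λ X → DeadEnding X → Compare G H X) step
  where
  step : InductiveStep (λ X → DeadEnding X → Compare G H X)
  step X ihL ihR d = ≤O-fromLw leftFirst , ≤O-fromRw rightFirst
    where
    leftFirst : oL (H ⊕ X) ≡ Lw → oL (G ⊕ X) ≡ Lw
    leftFirst e with oL-Lw⁻ (H ⊕ X) e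
    ... | inj₁ end = ≤O-Lw (hatL Lw Hbound X d (proj₂ (⊕-LeftEnd⁻ H X end))) refl
      where
      -- H is a Left-end, so ô_L(H) = Lw; by (1) also ô_L(G) = Lw.
      Hbound : LowerBoundL Lw H
      Hbound X' _ le' = ≤O-fromLw λ _ → oL-Lw-end (H ⊕ X') (⊕-LeftEnd H X' (proj₁ (⊕-LeftEnd⁻ H X end)) le')
    ... | inj₂ (y , p , e') with ⊕-leftOpt⁻ H X p
    ...   | inj₂ (x , q , refl) =
            oL-Lw-move (G ⊕ X) (⊕-leftOpt₂ G X q) (≤O-Lw (proj₂ (ihL x q (deadEnding-leftOpt d q))) e')
    ...   | inj₁ (HL , q , refl) with cond2 HL q
    ...     | inj₁ (GL , r , ge) = oL-Lw-move (G ⊕ X) (⊕-leftOpt₁ G X r) (≤O-Lw (proj₂ (ge X d)) e')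
    ...     | inj₂ (HLR , r , ge) = ≤O-Lw (proj₁ (ge X d)) (oR-Lw⁻ (HL ⊕ X) e' (⊕-rightOpt₁ HL X r))
    rightFirst : oR (G ⊕ X) ≡ Rw → oR (H ⊕ X) ≡ Rw
    rightFirst e with oR-Rw⁻ (G ⊕ X) e
    ... | inj₁ end = ≤O-Rw (hatR Rw Gbound X d (proj₂ (⊕-RightEnd⁻ G X end))) refl
      where
      -- G is a Right-end, so ô_R(G) = Rw; by (1) also ô_R(H) = Rw.
      Gbound : UpperBoundR Rw G
      Gbound Y _ re' = ≤O-fromRw λ _ → oR-Rw-end (G ⊕ Y) (⊕-RightEnd G Y (proj₁ (⊕-RightEnd⁻ G X end)) re')
    ... | inj₂ (y , p , e') with ⊕-rightOpt⁻ G X p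
    ...   | inj₂ (x , q , refl) =
            oR-Rw-move (H ⊕ X) (⊕-rightOpt₂ H X q) (≤O-Rw (proj₁ (ihR x q (deadEnding-rightOpt d q))) e')
    ...   | inj₁ (GR , q , refl) with cond3 GR q
    ...     | inj₁ (HR , r , ge) = oR-Rw-move (H ⊕ X) (⊕-rightOpt₁ H X r) (≤O-Rw (proj₁ (ge X d)) e')
    ...     | inj₂ (GRL , r , ge) = ≤O-Rw (proj₂ (ge X d)) (oL-Rw⁻ (GR ⊕ X) e' (⊕-leftOpt₁ GR X r))

hatO-necessary : ∀ G H → G ≥E H → hatO-≥ G H
hatO-necessary G H ge =
  (λ v Hbound X d le → ≤O-trans (Hbound X d le) (proj₁ (ge X d))) ,
  (λ v Gbound Y d re → ≤O-trans (proj₂ (ge Y d)) (Gbound Y d re))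

decHatL : ∀ G H → hatOL-≥ G H ⊎ SepL G H
decHatL G H with strongL G
... | inj₁ leftWins = inj₁ λ v _ X d le → ≤O-fromLw λ _ → leftWins X d le
... | inj₂ (X , d , le , eG) with oL (H ⊕ X) in eH
...   | Lw = inj₂ (sepL X d eH eG)
...   | Rw = inj₁ λ v Hbound _ _ _ → subst (_≤O _) (sym (≤O-Rw (Hbound X d le) eH)) R≤

decHatR : ∀ G H → hatOR-≥ G H ⊎ SepL G H
decHatR G H with strongR H
... | inj₁ rightWins = inj₁ λ v _ Y d re → ≤O-fromRw λ _ → rightWins Y d re
... | inj₂ (Y , d , re , eH) with oR (G ⊕ Y) in eG
...   | Rw = inj₂ (sepR⇒sepL (sepR Y d eH eG))
...   | Lw = inj₁ λ v Gbound _ _ _ → subst (_ ≤O_) (sym (≤O-Lw (Gbound Y d re) eG)) (≤Lw _)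

Dec≥ : Game → Game → Set
Dec≥ G H = G ≥E H ⊎ SepL G H

dec-conj : ∀ {G H} → Dec≥ G H → Dec≥ (conj H) (conj G)
dec-conj {G} {H} (inj₁ ge) = inj₁ (≥E-conj G H ge)
dec-conj (inj₂ w) = inj₂ (sepR⇒sepL (sepL-conj w))

DecBelow : Game → Game → Set
DecBelow G H = ∀ G' H' → depth G' + depth H' < depth G + depth H → Dec≥ G' H'

search : ∀ {P Q : Game → Set} l → (∀ g → g ∈ l → P g ⊎ Q g) →
  (Σ Game λ g → g ∈ l × P g) ⊎ (∀ g → g ∈ l → Q g)
search [] _ = inj₂ λ _ ()
search (x ∷ xs) decide with decide x (here refl)
... | inj₁ px = inj₁ (x , here refl , px)
... | inj₂ qx with search xs (λ g p → decide g (there p))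
...   | inj₁ (g , p , pg) = inj₁ (g , there p , pg)
...   | inj₂ qs = inj₂ λ { _ (here refl) → qx ; g (there p) → qs g p }

-- If Condition (2) fails at the Left option HL of H — every GL is separated from HL
-- and every HLR is separated from G — the separators combine into one game Z.
-- Left wins H ⊕ Z by moving to HL ⊕ Z: Right's replies in HL or to the Xs lose,
-- and his move to negInt n leaves him too many moves.  Left loses G ⊕ Z: her moves
-- in G are answered by the Xs, her moves to the Ys lose, and int n overloads her.
cond2-failure : ∀ {G H HL} → HL ∈ leftOpts H →
  (∀ GL → GL ∈ leftOpts G → SepL GL HL) → (∀ HLR → HLR ∈ rightOpts HL → SepR G HLR) → SepL G H
cond2-failure {G} {H} {HL} hl sepGL sepHLR = sepL Z dead leftWinsH leftLosesG
  where
  n : ℕ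
  n = depth G + depth H
  Xs Ys : List Game
  Xs = mapWith∈ (leftOpts G) (λ p → SepL.test (sepGL _ p))
  Ys = mapWith∈ (rightOpts HL) (λ q → SepR.test (sepHLR _ q))
  Z : Game
  Z = mk (int n ∷ Ys) (negInt n ∷ Xs)
  dead : DeadEnding Z
  dead = deadEnding-mk deadL deadR
    where
    deadL : ∀ z → z ∈ int n ∷ Ys → DeadEnding z
    deadL _ (here refl) = deadRightEnd⇒deadEnding (int-deadRightEnd n)
    deadL _ (there q) with mapWith∈⁻ (rightOpts HL) _ q
    ... | HLR , q' , refl = SepR.test-dead (sepHLR HLR q')
    deadR : ∀ z → z ∈ negInt n ∷ Xs → DeadEnding z
    deadR _ (here refl) = deadEnding-conj (deadRightEnd⇒deadEnding (int-deadRightEnd n))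
    deadR _ (there q) with mapWith∈⁻ (leftOpts G) _ q
    ... | GL , p , refl = SepL.test-dead (sepGL GL p)
  leftWinsH : oL (H ⊕ Z) ≡ Lw
  leftWinsH = oL-Lw-move (H ⊕ Z) (⊕-leftOpt₁ H Z hl)
                (oR-Lw⁺ (HL ⊕ Z) (nonEmpty (⊕-rightOpt₂ HL Z (here refl))) reply)
    where
    reply : ∀ y → y ∈ rightOpts (HL ⊕ Z) → oL y ≡ Lw
    reply y p with ⊕-rightOpt⁻ HL Z p
    ... | inj₁ (HLR , q , refl) = oL-Lw-move (HLR ⊕ Z) (⊕-leftOpt₂ HLR Z (there (mapWith∈⁺ _ (HLR , q , refl))))
                                    (SepR.leftWinsH (sepHLR HLR q))
    ... | inj₂ (_ , here refl , refl) = proj₁ (negInt-wins HL) n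
                                          (≤-trans (<⇒≤ (depth-leftOpt H hl)) (m≤n+m (depth H) (depth G)))
    ... | inj₂ (_ , there q , refl) with mapWith∈⁻ (leftOpts G) _ q
    ...   | GL , p' , refl = SepL.leftWinsH (sepGL GL p')
  leftLosesG : oL (G ⊕ Z) ≡ Rw
  leftLosesG = oL-Rw⁺ (G ⊕ Z) (nonEmpty (⊕-leftOpt₂ G Z (here refl))) reply
    where
    reply : ∀ y → y ∈ leftOpts (G ⊕ Z) → oR y ≡ Rw
    reply y p with ⊕-leftOpt⁻ G Z p
    ... | inj₁ (GL , q , refl) = oR-Rw-move (GL ⊕ Z) (⊕-rightOpt₂ GL Z (there (mapWith∈⁺ _ (GL , q , refl))))
                                   (SepL.leftLosesG (sepGL GL q))
    ... | inj₂ (_ , here refl , refl) = proj₁ (int-loses G) n (m≤m+n (depth G) (depth H))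
    ... | inj₂ (_ , there q , refl) with mapWith∈⁻ (rightOpts HL) _ q
    ...   | HLR , q' , refl = SepR.leftLosesG (sepHLR HLR q')

Cond2At : Game → Game → Set
Cond2At G HL = (Σ Game λ GL → GL ∈ leftOpts G × GL ≥E HL) ⊎ (Σ Game λ HLR → HLR ∈ rightOpts HL × G ≥E HLR)

decCond2 : ∀ G H → DecBelow G H → Cond2 G H ⊎ SepL G H
decCond2 G H below with search {Q = Cond2At G} (leftOpts H) atOption
  where
  atOption : ∀ HL → HL ∈ leftOpts H → SepL G H ⊎ Cond2At G HL
  atOption HL hl with search {P = _≥E HL} {Q = λ GL → SepL GL HL} (leftOpts G)
                       (λ GL p → below GL HL (+-mono-< (depth-leftOpt G p) (depth-leftOpt H hl)))
  ... | inj₁ found = inj₂ (inj₁ found)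
  ... | inj₂ sepGL with search {P = G ≥E_} {Q = SepL G} (rightOpts HL)
                          (λ HLR r → below G HLR (+-monoʳ-< (depth G) (<-trans (depth-rightOpt HL r) (depth-leftOpt H hl))))
  ...   | inj₁ found = inj₂ (inj₂ found)
  ...   | inj₂ sepHLR = inj₁ (cond2-failure hl sepGL (λ HLR r → sepL⇒sepR (sepHLR HLR r)))
... | inj₁ (_ , _ , w) = inj₂ w
... | inj₂ cond2 = inj₁ cond2

cond2-conj : ∀ G H → Cond2 (conj H) (conj G) → Cond3 G H
cond2-conj G H cond2 GR r with cond2 (conj GR) (leftOpt-conj G r)
... | inj₁ (_ , q , ge) with leftOpt-conj⁻ H q
...   | HR , q' , refl = inj₁ (HR , q' , ≥E-conj⁻ HR GR ge)
cond2-conj G H cond2 GR r | inj₂ (_ , q , ge) with rightOpt-conj⁻ GR q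
...   | GRL , q' , refl = inj₂ (GRL , q' , ≥E-conj⁻ H GRL ge)

depth-conj-swap : ∀ G H → depth (conj H) + depth (conj G) ≡ depth G + depth H
depth-conj-swap G H = trans (cong₂ _+_ (depth-conj H) (depth-conj G)) (+-comm (depth H) (depth G))

below-conj : ∀ G H → DecBelow G H → DecBelow (conj H) (conj G)
below-conj G H below G' H' lt =
  subst₂ Dec≥ (conj-invol G') (conj-invol H') (dec-conj (below (conj H') (conj G') lt'))
  where
  lt' : depth (conj H') + depth (conj G') < depth G + depth H
  lt' = subst₂ _<_ (sym (depth-conj-swap G' H')) (depth-conj-swap G H) lt

decCond3 : ∀ G H → DecBelow G H → Cond3 G H ⊎ SepL G H
decCond3 G H below with decCond2 (conj H) (conj G) (below-conj G H below)
... | inj₁ cond2 = inj₁ (cond2-conj G H cond2)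
... | inj₂ w = inj₂ (sepR⇒sepL (subst₂ SepR (conj-invol G) (conj-invol H) (sepL-conj w)))

decide-step : ∀ G H → DecBelow G H → Dec≥ G H
decide-step G H below with decHatL G H | decHatR G H | decCond2 G H below | decCond3 G H below
... | inj₁ hatL | inj₁ hatR | inj₁ cond2 | inj₁ cond3 = inj₁ (sufficient G H (hatL , hatR) cond2 cond3)
... | inj₂ w | _ | _ | _ = inj₂ w
... | _ | inj₂ w | _ | _ = inj₂ w
... | _ | _ | inj₂ w | _ = inj₂ w
... | _ | _ | _ | inj₂ w = inj₂ w

decide≥ : ∀ G H → Dec≥ G H
decide≥ G H = bounded (suc (depth G + depth H)) G H ≤-refl
  where
  bounded : ∀ n G H → depth G + depth H < n → Dec≥ G H
  bounded (suc n) G H lt = decide-step G H λ G' H' lt' → bounded n G' H' (<-≤-trans lt' (≤-pred lt))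

-- Theorem.
mainTheorem5 : (G H : Game) → DeadEnding G → DeadEnding H →
    (G ≥E H) ⇔ (hatO-≥ G H × Cond2 G H × Cond3 G H)
mainTheorem5 G H _ _ = mk⇔ necessary λ (hat , cond2 , cond3) → sufficient G H hat cond2 cond3
  where
  necessary : G ≥E H → hatO-≥ G H × Cond2 G H × Cond3 G H
  necessary ge = hatO-necessary G H ge , unrefuted (decCond2 G H below) , unrefuted (decCond3 G H below)
    where
    below : DecBelow G H
    below G' H' _ = decide≥ G' H'
    unrefuted : ∀ {C : Set} → C ⊎ SepL G H → C
    unrefuted (inj₁ c) = c
    unrefuted (inj₂ w) = ⊥-elim (sepL-refutes w ge)
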